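{- Let $p$ be an odd prime and let $\alpha>1$ be an integer with $\gcd(p,\alpha)=1$, let $\gamma=\operatorname{ord}_p(\alpha)$, and let $\tau>0$ be the integer with $p^{\tau}\,\|\,\alpha^\gamma-1$. Then for every integer $k\geq 0$, $$\left\{c_{\tau,k}\big((\alpha^b)_p\big) \;\middle|\; 0\leq b<\gamma p^k\right\}=\Lambda_k .$$
   Context: $p^k\,\|\,n$ means $p^k\mid n$ and $p^{k+1}\nmid n$. For a nonnegative integer $m$, $(m)_p$ denotes its base-$p$ representation $m=\sum_{i\ge0}a_ip^i$ with $0\le a_i<p$ (digits $a_i=0$ for large $i$). For such a digit sequence $a=(a_i)_{i\ge0}$, define $c_{\tau,k}(a)=\langle a_{\tau+k-1},\dots,a_{\tau+1},a_\tau,a_0\rangle$, the tuple consisting of the $k$ digits in positions $\tau+k-1,\dots,\tau$ followed by the digit in position $0$. Let $\delta=\{\alpha^j \bmod p : j\in\mathbb{Z}\}\subseteq\{0,1,\dots,p-1\}$ be the set of residues generated by $\alpha$ modulo $p$. For $n\ge0$, $\Lambda_n$ is the set of all tuples $\langle\sigma_n,\sigma_{n-1},\dots,\sigma_1,\sigma_0\rangle$ of integers with $\sigma_0\in\delta$ and $0\le\sigma_i<p$ for $1\le i\le n$. -}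

module Defs where

open import Data.Nat using (ℕ; zero; suc; _+_; _*_; _∸_; _^_; _<_; NonZero)
open import Data.Nat.DivMod using (_/_; _%_)
open import Data.Nat.Divisibility using (_∣_)
open import Data.Vec using (Vec; []; _∷_)
open import Data.Product using (∃; _×_)
open import Relation.Binary.PropositionalEquality using (_≡_)
open import Relation.Nullary using (¬_)

digit : (p : ℕ) → .{{NonZero p}} → ℕ → ℕ → ℕ
digit p zero    m = m % p
digit p (suc i) m = digit p i (m / p)

-- c_{τ,k}((m)_p) = ⟨a_{τ+k-1}, …, a_τ, a_0⟩  (a vector of length k+1)
c : (p : ℕ) → .{{NonZero p}} → (τ k : ℕ) → ℕ → Vec ℕ (suc k)
c p τ zero    m = digit p 0 m ∷ []
c p τ (suc k) m = digit p (τ + k) m ∷ c p τ k m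

Inδ : (p : ℕ) → .{{NonZero p}} → (α r : ℕ) → Set
Inδ p α r = ∃ λ j → r ≡ (α ^ j) % p

InΛ : (p : ℕ) → .{{NonZero p}} → (α : ℕ) → (n : ℕ) → Vec ℕ (suc n) → Set
InΛ p α zero    (σ₀ ∷ []) = Inδ p α σ₀
InΛ p α (suc n) (σ ∷ v)   = σ < p × InΛ p α n v

IsOrd : (p : ℕ) → .{{NonZero p}} → (α γ : ℕ) → Set
IsOrd p α γ = 0 < γ × (α ^ γ) % p ≡ 1 % p × (∀ j → 0 < j → j < γ → ¬ ((α ^ j) % p ≡ 1 % p))

ExactDiv : (p τ n : ℕ) → Set
ExactDiv p τ n = (p ^ τ) ∣ n × ¬ ((p ^ suc τ) ∣ n)

-- Write α^γ = 1 + p^τ w with p ∤ w. Since p is odd, p ∣ C(p,2), so p-th powers lift this exactly: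
-- α^(γ p^k) = 1 + p^(τ+k) w_k with p ∤ w_k. Hence, for a unit X and N = X α^(γ t),
-- X α^(γ (t + p^k m)) ≡ N + m w_k N p^(τ+k) (mod p^(τ+k+1)); as w_k N is invertible mod p, some
-- m < p fixes the next p-adic digit, and by induction the X α^(γ t) with t < p^k meet every residue
-- mod p^(τ+k) that is ≡ X mod p^τ. The tuple c_{τ,k} depends only on the residue mod p^(τ+k), and a
-- tuple of Λ_k whose last entry is α^i mod p (i < γ) is c_{τ,k}(R) for some R ≡ α^i mod p^τ; this
-- yields b = i + γ t < γ p^k.

module Submission where

open import Data.Nat
open import Data.Nat.Properties
open import Data.Nat.DivMod
open import Data.Nat.Divisibility
open import Data.Nat.Combinatorics using (_C_; nC1≡n; nCk+nC[k+1]≡[n+1]C[k+1])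
open import Data.Nat.Coprimality using (Coprime; coprime-Bézout)
open import Data.Nat.GCD using (module Bézout)
open import Data.Nat.Primality using (Prime; ¬prime[1]; euclidsLemma; prime⇒irreducible)
open import Data.Nat.Tactic.RingSolver using (solve-∀)
open import Data.Product using (∃; _×_; _,_; proj₁; proj₂)
open import Data.Sum using (inj₁; inj₂)
open import Data.Vec using (Vec; []; _∷_; init; last)
open import Data.Vec.Relation.Unary.All using (All; []; _∷_)
open import Function.Bundles using (_⇔_; mk⇔)
open import Relation.Binary.PropositionalEquality
open import Relation.Nullary using (¬_; contradiction)

open import Defs

open Bézout using (+-; -+)

infix 4 _≡_[mod_]
_≡_[mod_] : ℕ → ℕ → (n : ℕ) .{{_ : NonZero n}} → Set
a ≡ b [mod n ] = a % n ≡ b % n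

module _ {n} .{{_ : NonZero n}} where

  +-cong-mod : ∀ {a b c d} → a ≡ b [mod n ] → c ≡ d [mod n ] → a + c ≡ b + d [mod n ]
  +-cong-mod {a} {b} {c} {d} a≡b c≡d = begin
    (a + c) % n             ≡⟨ %-distribˡ-+ a c n ⟩
    (a % n + c % n) % n     ≡⟨ cong₂ (λ x y → (x + y) % n) a≡b c≡d ⟩
    (b % n + d % n) % n     ≡⟨ %-distribˡ-+ b d n ⟨
    (b + d) % n             ∎
    where open ≡-Reasoning

  *-cong-mod : ∀ {a b c d} → a ≡ b [mod n ] → c ≡ d [mod n ] → a * c ≡ b * d [mod n ]
  *-cong-mod {a} {b} {c} {d} a≡b c≡d = begin
    (a * c) % n             ≡⟨ %-distribˡ-* a c n ⟩
    (a % n * (c % n)) % n   ≡⟨ cong₂ (λ x y → (x * y) % n) a≡b c≡d ⟩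
    (b % n * (d % n)) % n   ≡⟨ %-distribˡ-* b d n ⟨
    (b * d) % n             ∎
    where open ≡-Reasoning

[m*n+o]%[p*n]≡[m%p]*n+o : ∀ m {n o} p .{{_ : NonZero p}} .{{_ : NonZero (p * n)}} →
                          o < n → (m * n + o) % (p * n) ≡ (m % p) * n + o
[m*n+o]%[p*n]≡[m%p]*n+o m {n} {o} p o<n = begin
  (m * n + o) % (p * n)      ≡⟨ [m*n+o]%[p*n]≡[m*n]%[p*n]+o m p o<n ⟩
  (m * n) % (p * n) + o      ≡⟨ cong (_+ o) (m%n*o≡m*o%[n*o] m p n) ⟨
  (m % p) * n + o            ∎
  where open ≡-Reasoning

m<n⇒o<p⇒m+n*o<p*n : ∀ {m n o p} → m < n → o < p → m + n * o < p * n
m<n⇒o<p⇒m+n*o<p*n {m} {n} {o} {p} m<n o<p = begin-strict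
  m + n * o   <⟨ +-monoˡ-< (n * o) m<n ⟩
  n + n * o   ≡⟨ *-suc n o ⟨
  n * suc o   ≤⟨ *-monoʳ-≤ n o<p ⟩
  n * p       ≡⟨ *-comm n p ⟩
  p * n       ∎
  where open ≤-Reasoning

^-monoʳ-∣ : ∀ m {n o} → n ≤ o → m ^ n ∣ m ^ o
^-monoʳ-∣ m z≤n       = 1∣ _
^-monoʳ-∣ m (s≤s n≤o) = *-monoʳ-∣ m (^-monoʳ-∣ m n≤o)

nC2-suc : ∀ n → suc n C 2 ≡ n + n C 2
nC2-suc n = trans (sym (nCk+nC[k+1]≡[n+1]C[k+1] n 1)) (cong (_+ n C 2) (nC1≡n n))

binomial-mod-cube : ∀ x n → ∃ λ E → (1 + x) ^ n ≡ 1 + n * x + x * x * (n C 2 + x * E)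
binomial-mod-cube x zero    = 0 , base x
  where
  base : ∀ x → 1 ≡ 1 + 0 * x + x * x * (0 + x * 0)
  base = solve-∀
binomial-mod-cube x (suc n) with binomial-mod-cube x n
... | E , eq = E + n C 2 + x * E , (begin
  (1 + x) * (1 + x) ^ n                                        ≡⟨ cong ((1 + x) *_) eq ⟩
  (1 + x) * (1 + n * x + x * x * (n C 2 + x * E))              ≡⟨ expand x n (n C 2) E ⟩
  1 + suc n * x + x * x * ((n + n C 2) + x * (E + n C 2 + x * E)) ≡⟨ cong (λ c → 1 + suc n * x + x * x * (c + x * (E + n C 2 + x * E))) (nC2-suc n) ⟨
  1 + suc n * x + x * x * (suc n C 2 + x * (E + n C 2 + x * E)) ∎)
  where
  open ≡-Reasoning
  expand : ∀ x n c E → (1 + x) * (1 + n * x + x * x * (c + x * E)) ≡ 1 + (1 + n) * x + x * x * ((n + c) + x * (E + c + x * E))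
  expand = solve-∀

nC2+nC2+n≡n*n : ∀ n → n C 2 + n C 2 + n ≡ n * n
nC2+nC2+n≡n*n zero    = refl
nC2+nC2+n≡n*n (suc n) = begin
  suc n C 2 + suc n C 2 + suc n        ≡⟨ cong (λ c → c + c + suc n) (nC2-suc n) ⟩
  (n + n C 2) + (n + n C 2) + (1 + n)  ≡⟨ regroup n (n C 2) ⟩
  (n C 2 + n C 2 + n) + (1 + n + n)    ≡⟨ cong (_+ (1 + n + n)) (nC2+nC2+n≡n*n n) ⟩
  n * n + (1 + n + n)                  ≡⟨ square n ⟩
  suc n * suc n                        ∎
  where
  open ≡-Reasoning
  regroup : ∀ n c → (n + c) + (n + c) + (1 + n) ≡ (c + c + n) + (1 + n + n)
  regroup = solve-∀
  square : ∀ n → n * n + (1 + n + n) ≡ (1 + n) * (1 + n)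
  square = solve-∀

odd⇒∣nC2 : ∀ n → n % 2 ≡ 1 → n ∣ n C 2
odd⇒∣nC2 n odd = divides h (*-cancelʳ-≡ _ _ 2 (+-cancelʳ-≡ n _ _ (begin
  (n C 2) * 2 + n          ≡⟨ cong (_+ n) (*-comm (n C 2) 2) ⟩
  n C 2 + (n C 2 + 0) + n  ≡⟨ cong (λ c → n C 2 + c + n) (+-identityʳ (n C 2)) ⟩
  n C 2 + n C 2 + n        ≡⟨ nC2+nC2+n≡n*n n ⟩
  n * n                    ≡⟨ cong (n *_) n≡1+h*2 ⟩
  n * (1 + h * 2)          ≡⟨ expand n h ⟩
  h * n * 2 + n            ∎)))
  where
  open ≡-Reasoning
  h = n / 2
  n≡1+h*2 : n ≡ 1 + h * 2
  n≡1+h*2 = trans (m≡m%n+[m/n]*n n 2) (cong (_+ h * 2) odd)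
  expand : ∀ n h → n * (1 + h * 2) ≡ h * n * 2 + n
  expand = solve-∀

lifting-the-exponent : ∀ {p M w} → p % 2 ≡ 1 → p ∣ M → ¬ p ∣ w →
                       ∃ λ w′ → (1 + M * w) ^ p ≡ 1 + p * M * w′ × ¬ p ∣ w′
lifting-the-exponent {p} {_} {w} p-odd (divides q refl) p∤w
  with binomial-mod-cube (q * p * w) p | odd⇒∣nC2 p p-odd
... | E , eq | divides h pC2≡h*p = p * W + w , (begin
  (1 + x) ^ p                          ≡⟨ eq ⟩
  1 + p * x + x * x * (p C 2 + x * E)  ≡⟨ cong (λ c → 1 + p * x + x * x * (c + x * E)) pC2≡h*p ⟩
  1 + p * x + x * x * (h * p + x * E)  ≡⟨ regroup p q w h E ⟩
  1 + p * (q * p) * (p * W + w)        ∎) , λ p∣w′ → p∤w (∣m+n∣m⇒∣n p∣w′ (m∣m*n W))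
  where
  open ≡-Reasoning
  x = q * p * w
  W = q * w * w * (h + q * w * E)
  regroup : ∀ p q w h E →
            1 + p * (q * p * w) + q * p * w * (q * p * w) * (h * p + q * p * w * E)
            ≡ 1 + p * (q * p) * (p * (q * w * w * (h + q * w * E)) + w)
  regroup = solve-∀

[1+M*w]^m≡1+m*w*M : ∀ {p M} .{{_ : NonZero (p * M)}} → p ∣ M → ∀ w m →
                    (1 + M * w) ^ m ≡ 1 + m * w * M [mod p * M ]
[1+M*w]^m≡1+m*w*M {p} {M} p∣M w m with binomial-mod-cube (M * w) m
... | E , eq = begin
  (1 + M * w) ^ m % (p * M)              ≡⟨ cong (_% (p * M)) (trans eq (regroup M w m (m C 2) E)) ⟩
  (1 + m * w * M + Q * (M * M)) % (p * M) ≡⟨ %-remove-+ʳ (1 + m * w * M) (∣n⇒∣m*n Q (*-monoˡ-∣ M p∣M)) ⟩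
  (1 + m * w * M) % (p * M)              ∎
  where
  open ≡-Reasoning
  Q = w * w * (m C 2 + M * w * E)
  regroup : ∀ M w m c E →
            1 + m * (M * w) + M * w * (M * w) * (c + M * w * E) ≡ 1 + m * w * M + w * w * (c + M * w * E) * (M * M)
  regroup = solve-∀

m^[n+o*k]≡m^n*[m^o]^k : ∀ m n o k → m ^ (n + o * k) ≡ m ^ n * (m ^ o) ^ k
m^[n+o*k]≡m^n*[m^o]^k m n o k = trans (^-distribˡ-+-* m n (o * k)) (cong (m ^ n *_) (sym (^-*-assoc m o k)))

^-cong-mod : ∀ {n a b} .{{_ : NonZero n}} → a ≡ b [mod n ] → ∀ k → a ^ k ≡ b ^ k [mod n ]
^-cong-mod a≡b zero    = refl
^-cong-mod a≡b (suc k) = *-cong-mod a≡b (^-cong-mod a≡b k)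

a^γ≡1⇒a^j≡a^[j%γ] : ∀ {n a γ} .{{_ : NonZero n}} .{{_ : NonZero γ}} → a ^ γ ≡ 1 [mod n ] →
            ∀ j → a ^ j ≡ a ^ (j % γ) [mod n ]
a^γ≡1⇒a^j≡a^[j%γ] {n} {a} {γ} a^γ≡1 j = begin
  a ^ j % n                                ≡⟨ cong (λ i → a ^ i % n) (trans (m≡m%n+[m/n]*n j γ) (cong (j % γ +_) (*-comm (j / γ) γ))) ⟩
  a ^ (j % γ + γ * (j / γ)) % n            ≡⟨ cong (_% n) (m^[n+o*k]≡m^n*[m^o]^k a (j % γ) γ (j / γ)) ⟩
  a ^ (j % γ) * (a ^ γ) ^ (j / γ) % n      ≡⟨ *-cong-mod {a = a ^ (j % γ)} refl (^-cong-mod a^γ≡1 (j / γ)) ⟩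
  a ^ (j % γ) * 1 ^ (j / γ) % n            ≡⟨ cong (λ z → a ^ (j % γ) * z % n) (^-zeroˡ (j / γ)) ⟩
  a ^ (j % γ) * 1 % n                      ≡⟨ cong (_% n) (*-identityʳ (a ^ (j % γ))) ⟩
  a ^ (j % γ) % n                          ∎
  where open ≡-Reasoning

exactDiv⇒≡1+p^τ*w : ∀ {p τ a} → 0 < a → ExactDiv p τ (a ∸ 1) → ∃ λ w → a ≡ 1 + p ^ τ * w × ¬ p ∣ w
exactDiv⇒≡1+p^τ*w {p} {τ} {a} 0<a (divides w eq , p^1+τ∤) =
  w , trans (sym (m+[n∸m]≡n 0<a)) (cong (1 +_) (trans eq (*-comm w (p ^ τ)))) , p∤w
  where
  p∤w : ¬ p ∣ w
  p∤w (divides q w≡q*p) = p^1+τ∤ (divides q (trans eq (trans (cong (_* p ^ τ) w≡q*p) (*-assoc q p (p ^ τ)))))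

bézout⇒inverse : ∀ {u n} .{{_ : NonZero n}} → Bézout.Identity 1 u n → ∃ λ v → v * u ≡ 1 [mod n ]
bézout⇒inverse {u} {n} (+- x y eq) = x , (begin
  x * u % n        ≡⟨ cong (_% n) eq ⟨
  (1 + y * n) % n  ≡⟨ [m+kn]%n≡m%n 1 y n ⟩
  1 % n            ∎)
  where open ≡-Reasoning
-- Here x * u ≡ -1 and n ≡ -1 modulo suc n.
bézout⇒inverse {u} {suc n} (-+ x y eq) = n * x , (begin
  n * x * u % suc n                     ≡⟨ [m+kn]%n≡m%n (n * x * u) 1 (suc n) ⟨
  (n * x * u + 1 * suc n) % suc n       ≡⟨ cong (_% suc n) (trans (expand n x u) (cong (λ z → 1 + n * z) eq)) ⟩
  (1 + n * (y * suc n)) % suc n         ≡⟨ cong (_% suc n) (cong (1 +_) (sym (*-assoc n y (suc n)))) ⟩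
  (1 + n * y * suc n) % suc n           ≡⟨ [m+kn]%n≡m%n 1 (n * y) (suc n) ⟩
  1 % suc n                             ∎)
  where
  open ≡-Reasoning
  expand : ∀ n x u → n * x * u + 1 * suc n ≡ 1 + n * (1 + x * u)
  expand = solve-∀

≡-mod-weaken : ∀ {d n a b} .{{_ : NonZero d}} .{{_ : NonZero n}} → d ∣ n → a ≡ b [mod n ] → a ≡ b [mod d ]
≡-mod-weaken {d} {n} {a} {b} d∣n a≡b = begin
  a % d      ≡⟨ m∣n⇒o%n%m≡o%m d n a d∣n ⟨
  a % n % d  ≡⟨ cong (_% d) a≡b ⟩
  b % n % d  ≡⟨ m∣n⇒o%n%m≡o%m d n b d∣n ⟩
  b % d      ∎
  where open ≡-Reasoning

module Radix (p : ℕ) .{{_ : NonZero p}} where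

  -- Instance search cannot find NonZero (p ^ n) for a variable n; it is always supplied explicitly.
  infix 4 _≡_[mod-p^_]
  _≡_[mod-p^_] : ℕ → ℕ → ℕ → Set
  a ≡ b [mod-p^ n ] = a ≡ b [mod p ^ n ]
    where instance _ = m^n≢0 p n

  digit<p : ∀ i m → digit p i m < p
  digit<p zero    m = m%n<n m p
  digit<p (suc i) m = digit<p i (m / p)

  digit-cong : ∀ {i n m m′} → i < n → m ≡ m′ [mod-p^ n ] → digit p i m ≡ digit p i m′
  digit-cong {zero}  {suc n}          _         m≡m′ = ≡-mod-weaken (m∣m*n (p ^ n)) m≡m′
    where instance _ = m^n≢0 p (suc n)
  digit-cong {suc i} {suc n} {m} {m′} (s<s i<n) m≡m′ = digit-cong i<n (begin
    m / p % p ^ n           ≡⟨ shift m ⟨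
    m % (p * p ^ n) / p     ≡⟨ cong (_/ p) m≡m′ ⟩
    m′ % (p * p ^ n) / p    ≡⟨ shift m′ ⟩
    m′ / p % p ^ n          ∎)
    where
    open ≡-Reasoning
    instance
      _ = m^n≢0 p n
      _ = m^n≢0 p (suc n)
      _ = m*n≢0 (p ^ n) p
    shift : ∀ x → x % (p * p ^ n) / p ≡ x / p % p ^ n
    shift x = trans (/-congˡ (%-congʳ (*-comm p (p ^ n)))) (m%[n*o]/o≡m/o%n x (p ^ n) p)

  c-cong : ∀ {τ n m m′} → 0 < τ → ∀ k → τ + k ≤ n → m ≡ m′ [mod-p^ n ] → c p τ k m ≡ c p τ k m′
  c-cong {τ} 0<τ zero    τ+0≤n m≡m′ =
    cong (_∷ []) (digit-cong (<-≤-trans 0<τ (≤-trans (m≤m+n τ 0) τ+0≤n)) m≡m′)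
  c-cong {τ} {n} 0<τ (suc k) τ+1+k≤n m≡m′ =
    cong₂ _∷_ (digit-cong τ+k<n m≡m′) (c-cong 0<τ k (<⇒≤ τ+k<n) m≡m′)
    where
    τ+k<n = subst (_≤ n) (+-suc τ k) τ+1+k≤n

  digit-top : ∀ i {r} y → r < p ^ i → digit p i (r + p ^ i * y) ≡ y % p
  digit-top zero    {zero}  y _         = cong (_% p) (+-identityʳ y)
  digit-top zero    {suc r} y (s≤s ())
  digit-top (suc i) {r}     y r<p*p^i = trans (cong (digit p i) shift) (digit-top i y r/p<p^i)
    where
    shift : (r + p * p ^ i * y) / p ≡ r / p + p ^ i * y
    shift = trans (+-distrib-/-∣ʳ r (∣m⇒∣m*n y (m∣m*n (p ^ i))))
                  (cong (r / p +_) (trans (/-congˡ (trans (*-assoc p (p ^ i) y) (*-comm p (p ^ i * y))))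
                                          (m*n/n≡m (p ^ i * y) p)))
    r/p<p^i : r / p < p ^ i
    r/p<p^i = m<n*o⇒m/o<n (subst (r <_) (*-comm p (p ^ i)) r<p*p^i)

  realise-digits : ∀ {τ} → 0 < τ → ∀ k X (v : Vec ℕ (suc k)) → All (_< p) (init v) → last v ≡ X % p →
                   ∃ λ R → R ≡ X [mod-p^ τ ] × c p τ k R ≡ v
  realise-digits {τ} 0<τ zero X (σ₀ ∷ []) [] σ₀≡X%p =
    X % p ^ τ , X%p^τ≡X , cong (_∷ []) (trans (digit-cong 0<τ X%p^τ≡X) (sym σ₀≡X%p))
    where
    instance _ = m^n≢0 p τ
    X%p^τ≡X : X % p ^ τ ≡ X [mod-p^ τ ]
    X%p^τ≡X = m%n%n≡m%n X (p ^ τ)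
  realise-digits {τ} 0<τ (suc k) X (σ ∷ v) (σ<p ∷ init<p) last≡X%p with realise-digits 0<τ k X v init<p last≡X%p
  ... | R , R≡X , cR≡v = R′ , R′≡X , cong₂ _∷_ top (trans (c-cong 0<τ k ≤-refl R′≡R) cR≡v)
    where
    open ≡-Reasoning
    P = p ^ (τ + k)
    instance
      _ = m^n≢0 p τ
      _ = m^n≢0 p (τ + k)
    R′ = R % P + P * σ
    top : digit p (τ + k) R′ ≡ σ
    top = trans (digit-top (τ + k) σ (m%n<n R P)) (m<n⇒m%n≡m σ<p)
    R′≡R : R′ ≡ R [mod-p^ (τ + k) ]
    R′≡R = begin
      (R % P + P * σ) % P  ≡⟨ cong (λ z → (R % P + z) % P) (*-comm P σ) ⟩
      (R % P + σ * P) % P  ≡⟨ [m+kn]%n≡m%n (R % P) σ P ⟩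
      R % P % P            ≡⟨ m%n%n≡m%n R P ⟩
      R % P                ∎
    R′≡X : R′ ≡ X [mod-p^ τ ]
    R′≡X = trans (≡-mod-weaken (^-monoʳ-∣ p (m≤m+n τ k)) R′≡R) R≡X

  c∈Λ : ∀ α τ k m → Inδ p α (m % p) → InΛ p α k (c p τ k m)
  c∈Λ α τ zero    m m%p∈δ = m%p∈δ
  c∈Λ α τ (suc k) m m%p∈δ = digit<p (τ + k) m , c∈Λ α τ k m m%p∈δ

  Λ⇒init<p×last∈δ : ∀ α k (v : Vec ℕ (suc k)) → InΛ p α k v → All (_< p) (init v) × Inδ p α (last v)
  Λ⇒init<p×last∈δ α zero    (σ₀ ∷ []) σ₀∈δ       = [] , σ₀∈δ
  Λ⇒init<p×last∈δ α (suc k) (σ ∷ v)   (σ<p , v∈Λ) with Λ⇒init<p×last∈δ α k v v∈Λ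
  ... | init<p , last∈δ = σ<p ∷ init<p , last∈δ

module Units (p : ℕ) .{{_ : NonZero p}} (p-prime : Prime p) where

  p∤1 : ¬ p ∣ 1
  p∤1 p∣1 = ¬prime[1] (subst Prime (∣1⇒≡1 p∣1) p-prime)

  ∤-* : ∀ {m n} → ¬ p ∣ m → ¬ p ∣ n → ¬ p ∣ m * n
  ∤-* {m} {n} p∤m p∤n p∣m*n with euclidsLemma m n p-prime p∣m*n
  ... | inj₁ p∣m = p∤m p∣m
  ... | inj₂ p∣n = p∤n p∣n

  ∤-^ : ∀ {m} n → ¬ p ∣ m → ¬ p ∣ m ^ n
  ∤-^ zero    _   = p∤1
  ∤-^ (suc n) p∤m = ∤-* p∤m (∤-^ n p∤m)

  coprime⇒∤ : ∀ {a} → Coprime p a → ¬ p ∣ a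
  coprime⇒∤ p⊥a p∣a = p∤1 (subst (p ∣_) (p⊥a (∣-refl , p∣a)) ∣-refl)

  ∤⇒coprime : ∀ {u} → ¬ p ∣ u → Coprime u p
  ∤⇒coprime p∤u (d∣u , d∣p) with prime⇒irreducible p-prime d∣p
  ... | inj₁ d≡1  = d≡1
  ... | inj₂ refl = contradiction d∣u p∤u

  inverse : ∀ {u} → ¬ p ∣ u → ∃ λ v → v * u ≡ 1 [mod p ]
  inverse p∤u = bézout⇒inverse (coprime-Bézout (∤⇒coprime p∤u))

  solve-linear : ∀ {u} → ¬ p ∣ u → ∀ e f → ∃ λ m → m < p × e + m * u ≡ f [mod p ]
  solve-linear {u} p∤u e f with inverse p∤u
  ... | v , v*u≡1 = d * v % p , m%n<n (d * v) p , (begin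
    (e + d * v % p * u) % p  ≡⟨ +-cong-mod {a = e} refl (*-cong-mod {c = u} (m%n%n≡m%n (d * v) p) refl) ⟩
    (e + d * v * u) % p      ≡⟨ cong (λ z → (e + z) % p) (*-assoc d v u) ⟩
    (e + d * (v * u)) % p    ≡⟨ +-cong-mod {a = e} refl (*-cong-mod {a = d} refl v*u≡1) ⟩
    (e + d * 1) % p          ≡⟨ cong (_% p) (trans (regroup e f (pred p)) (cong (λ q → f + e * q) (suc-pred p))) ⟩
    (f + e * p) % p          ≡⟨ [m+kn]%n≡m%n f e p ⟩
    f % p                    ∎)
    where
    open ≡-Reasoning
    -- d ≡ f - e (mod p), because pred p ≡ -1.
    d = f + pred p * e
    regroup : ∀ e f q → e + (f + q * e) * 1 ≡ f + e * (1 + q)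
    regroup = solve-∀

  -- In base M, N and R share the last digit N % M, and m is chosen to match the next one.
  lift-congruence : ∀ {M u N R} .{{_ : NonZero M}} .{{_ : NonZero (p * M)}} → ¬ p ∣ u → N ≡ R [mod M ] →
                    ∃ λ m → m < p × N + m * u * M ≡ R [mod p * M ]
  lift-congruence {M} {u} {N} {R} p∤u N≡R with solve-linear p∤u (N / M) (R / M)
  ... | m , m<p , lin = m , m<p , (begin
    (N + m * u * M) % (p * M)                ≡⟨ cong (_% (p * M)) regroup ⟩
    ((N / M + m * u) * M + N % M) % (p * M)  ≡⟨ [m*n+o]%[p*n]≡[m%p]*n+o (N / M + m * u) p (m%n<n N M) ⟩
    (N / M + m * u) % p * M + N % M          ≡⟨ cong₂ (λ a b → a * M + b) lin N≡R ⟩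
    R / M % p * M + R % M                    ≡⟨ [m*n+o]%[p*n]≡[m%p]*n+o (R / M) p (m%n<n R M) ⟨
    (R / M * M + R % M) % (p * M)            ≡⟨ cong (_% (p * M)) (trans (+-comm (R / M * M) (R % M)) (sym (m≡m%n+[m/n]*n R M))) ⟩
    R % (p * M)                              ∎)
    where
    open ≡-Reasoning
    expand : ∀ r q m u M → r + q * M + m * u * M ≡ (q + m * u) * M + r
    expand = solve-∀
    regroup : N + m * u * M ≡ (N / M + m * u) * M + N % M
    regroup = trans (cong (_+ m * u * M) (m≡m%n+[m/n]*n N M)) (expand (N % M) (N / M) m u M)

module Generation (p : ℕ) .{{_ : NonZero p}} (p-prime : Prime p) (p-odd : p % 2 ≡ 1)
                  {A τ w : ℕ} (0<τ : 0 < τ) (A≡1+p^τ*w : A ≡ 1 + p ^ τ * w) (p∤w : ¬ p ∣ w) where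

  open Radix p
  open Units p p-prime

  p∣p^[k+τ] : ∀ k → p ∣ p ^ (k + τ)
  p∣p^[k+τ] k = ∣-trans (m∣m*n 1) (^-monoʳ-∣ p (≤-trans 0<τ (m≤n+m τ k)))

  p∤A : ¬ p ∣ A
  p∤A p∣A = p∤1 (∣m+n∣m⇒∣n (subst (p ∣_) (trans A≡1+p^τ*w (+-comm 1 _)) p∣A) (∣m⇒∣m*n w (p∣p^[k+τ] 0)))

  A^p^k≡1+p^[k+τ]*w : ∀ k → ∃ λ w′ → A ^ (p ^ k) ≡ 1 + p ^ (k + τ) * w′ × ¬ p ∣ w′
  A^p^k≡1+p^[k+τ]*w zero    = w , trans (^-identityʳ A) A≡1+p^τ*w , p∤w
  A^p^k≡1+p^[k+τ]*w (suc k) with A^p^k≡1+p^[k+τ]*w k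
  ... | w′ , A^p^k≡ , p∤w′ with lifting-the-exponent p-odd (p∣p^[k+τ] k) p∤w′
  ... | w″ , lifted , p∤w″ = w″ , (begin
    A ^ (p * p ^ k)              ≡⟨ cong (A ^_) (*-comm p (p ^ k)) ⟩
    A ^ (p ^ k * p)              ≡⟨ ^-*-assoc A (p ^ k) p ⟨
    (A ^ (p ^ k)) ^ p            ≡⟨ cong (_^ p) A^p^k≡ ⟩
    (1 + p ^ (k + τ) * w′) ^ p   ≡⟨ lifted ⟩
    1 + p * p ^ (k + τ) * w″     ∎) , p∤w″
    where open ≡-Reasoning

  reach-next-digit : ∀ k {X R t} → ¬ p ∣ X → X * A ^ t ≡ R [mod-p^ (k + τ) ] →
                     ∃ λ m → m < p × X * A ^ (t + p ^ k * m) ≡ R [mod-p^ (suc k + τ) ]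
  reach-next-digit k {X} {R} {t} p∤X N≡R =
    let w′ , A^p^k≡ , p∤w′ = A^p^k≡1+p^[k+τ]*w k
        m , m<p , lifted   = lift-congruence {M = M} (∤-* p∤w′ (∤-* p∤X (∤-^ t p∤A))) N≡R
    in m , m<p , (begin
      X * A ^ (t + p ^ k * m) % (p * M)                   ≡⟨ cong (λ z → X * z % (p * M)) (m^[n+o*k]≡m^n*[m^o]^k A t (p ^ k) m) ⟩
      X * (A ^ t * (A ^ (p ^ k)) ^ m) % (p * M)           ≡⟨ cong (_% (p * M)) (trans (sym (*-assoc X _ _)) (cong (λ z → X * A ^ t * z ^ m) A^p^k≡)) ⟩
      X * A ^ t * (1 + M * w′) ^ m % (p * M)              ≡⟨ *-cong-mod {n = p * M} {a = X * A ^ t} refl ([1+M*w]^m≡1+m*w*M (p∣p^[k+τ] k) w′ m) ⟩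
      X * A ^ t * (1 + m * w′ * M) % (p * M)              ≡⟨ cong (_% (p * M)) (expand (X * A ^ t) m w′ M) ⟩
      (X * A ^ t + m * (w′ * (X * A ^ t)) * M) % (p * M)  ≡⟨ lifted ⟩
      R % (p * M)                                         ∎)
    where
    open ≡-Reasoning
    M = p ^ (k + τ)
    instance
      _ = m^n≢0 p (k + τ)
      _ = m^n≢0 p (suc k + τ)
    expand : ∀ N m w M → N * (1 + m * w * M) ≡ N + m * (w * N) * M
    expand = solve-∀

  reach : ∀ k {X R} → ¬ p ∣ X → X ≡ R [mod-p^ τ ] → ∃ λ t → t < p ^ k × X * A ^ t ≡ R [mod-p^ (k + τ) ]
  reach zero    {X} p∤X X≡R = 0 , s≤s z≤n , trans (cong (_% p ^ τ) (*-identityʳ X)) X≡R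
    where instance _ = m^n≢0 p τ
  reach (suc k) p∤X X≡R =
    let t , t<p^k , N≡R = reach k p∤X X≡R
        m , m<p , N′≡R  = reach-next-digit k {t = t} p∤X N≡R
    in t + p ^ k * m , m<n⇒o<p⇒m+n*o<p*n t<p^k m<p , N′≡R

theorem2p9 : (p α γ τ : ℕ) → .{{_ : NonZero p}} → Prime p → p % 2 ≡ 1
    → 1 < α → Coprime p α → IsOrd p α γ → 0 < τ → ExactDiv p τ (α ^ γ ∸ 1)
    → (k : ℕ) → (v : Vec ℕ (suc k))
    → (∃ λ b → b < γ * p ^ k × c p τ k (α ^ b) ≡ v) ⇔ InΛ p α k v
theorem2p9 p α γ τ p-prime p-odd 1<α p⊥α (0<γ , α^γ≡1 , _) 0<τ p^τ∥α^γ∸1 k v = mk⇔ to from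
  where
  open Radix p
  open Units p p-prime
  instance
    _ = >-nonZero 0<γ
    _ = >-nonZero (<-trans z<s 1<α)
    _ = m^n≢0 p (k + τ)
  α^γ-expansion = exactDiv⇒≡1+p^τ*w {p} {τ} (m^n>0 α γ) p^τ∥α^γ∸1
  open Generation p p-prime p-odd 0<τ (proj₁ (proj₂ α^γ-expansion)) (proj₂ (proj₂ α^γ-expansion))

  to : (∃ λ b → b < γ * p ^ k × c p τ k (α ^ b) ≡ v) → InΛ p α k v
  to (b , _ , refl) = c∈Λ α τ k (α ^ b) (b , refl)

  from : InΛ p α k v → ∃ λ b → b < γ * p ^ k × c p τ k (α ^ b) ≡ v
  from v∈Λ =
    let init<p , j , last≡α^j  = Λ⇒init<p×last∈δ α k v v∈Λ
        i                      = j % γ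
        last≡α^i               = trans last≡α^j (a^γ≡1⇒a^j≡a^[j%γ] {γ = γ} α^γ≡1 j)
        R , R≡α^i , cR≡v       = realise-digits 0<τ k (α ^ i) v init<p last≡α^i
        t , t<p^k , α^i*α^γt≡R = reach k (∤-^ i (coprime⇒∤ p⊥α)) (sym R≡α^i)
        α^[i+γt]≡R             = trans (cong (_% p ^ (k + τ)) (m^[n+o*k]≡m^n*[m^o]^k α i γ t)) α^i*α^γt≡R
    in i + γ * t ,
       subst (i + γ * t <_) (*-comm (p ^ k) γ) (m<n⇒o<p⇒m+n*o<p*n (m%n<n j γ) t<p^k) ,
       trans (c-cong 0<τ k (≤-reflexive (+-comm τ k)) α^[i+γt]≡R) cR≡v
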